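{- For integers $n\ge0$ and $k$, let $E_{n,k}$ be the number of $e\in\mathbf{I}_n(000)$ with exactly $k$ distinct entries (so $E_{0,0}=1$, and $E_{n,k}=0$ if $k>n$ or $k<\lceil n/2\rceil$). Then for all $n\ge1$ and $1\le k\le n$, $$E_{n,k}=(n-k+1)E_{n-1,k-1}+(2k-n+1)E_{n-1,k}.$$
   Context: An inversion sequence of length $n$ is an integer sequence $e=(e_1,\ldots,e_n)$ with $0 \le e_i < i$ for all $i$; $\mathbf{I}_n$ is the set of these ($\mathbf{I}_0$ consists of the empty sequence). $\mathbf{I}_n(000)$ is the set of $e\in\mathbf{I}_n$ in which no value occurs three or more times. -}

module Defs where

open import Data.Nat using (ℕ; zero; suc; _<_; _≤_; _≟_; _<?_; _≤?_)
open import Data.List using (List; []; _∷_; _++_; [_]; map; concatMap; upTo; length; filter; deduplicate)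
open import Data.List.Relation.Unary.All using (All; all?)
open import Relation.Nullary using (¬_; Dec)
open import Relation.Binary.PropositionalEquality using (_≡_)

-- An inversion sequence e = (e_1,...,e_n) is represented as the list
-- e_1 ∷ ... ∷ e_n ∷ [] of naturals.

I : ℕ → List (List ℕ)
I zero = [] ∷ []
I (suc n) = concatMap (λ e → map (λ x → e ++ [ x ]) (upTo (suc n))) (I n)

occ : ℕ → List ℕ → ℕ
occ v e = length (filter (λ x → x ≟ v) e)

Avoids000 : List ℕ → Set
Avoids000 e = All (λ v → occ v e < 3) e

avoids000? : (e : List ℕ) → Dec (Avoids000 e)
avoids000? e = all? (λ v → occ v e <? 3) e

I000 : ℕ → List (List ℕ)
I000 n = filter avoids000? (I n)

distinct : List ℕ → ℕ
distinct e = length (deduplicate _≟_ e)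

E : ℕ → ℕ → ℕ
E n k = length (filter (λ e → distinct e ≟ k) (I000 n))

module Submission where

-- Every sequence of I(n+1) is uniquely e ++ [x] with e ∈ I(n) and x ≤ n, so
-- E(n+1,k) is a double sum over e and x.  Fix e avoiding 000 with d distinct
-- values, and let aⱼ be the number of values v ≤ n occurring exactly j times
-- in e.  Appending x preserves avoidance iff x occurs at most once in e, and
-- the result has d+1 distinct values if x was absent, d if it occurred once;
-- so the inner sum is [d+1 = k]·a₀ + [d = k]·a₁.  Counting values and entries
-- of e gives a₀ + d = n+1 and a₁ + n = 2d, which turns the inner sum into
-- (n+1-k+1)·[d = k-1] + (2k-(n+1)+1)·[d = k]; summing over e gives the theorem.

open import Defs
open import Data.Nat using (ℕ; suc; _≤_; _∸_)
open import Data.Integer using (ℤ; +_; _+_; _-_; _*_)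
open import Relation.Binary.PropositionalEquality using (_≡_)

-- Addition and multiplication of naturals are written ⊕ and ⊗, because + and *
-- denote the integer operations of the statement.
open import Data.Nat using (zero; _<_; s≤s; z≤n; _≟_; _<?_)
  renaming (_+_ to _⊕_; _*_ to _⊗_)
import Data.Nat.Properties as ℕP
import Data.Integer.Properties as ℤP
open import Data.List using (List; []; _∷_; _++_; [_]; map; concatMap; upTo; length; filter; deduplicate)
import Data.List.Properties as ListP
open import Data.List.Relation.Unary.All as All using (All; []; _∷_)
import Data.List.Relation.Unary.All.Properties as AllP
open import Data.List.Membership.Propositional using (_∈_)
open import Data.List.Relation.Unary.Any using (here; there)
open import Data.Product using (_×_; _,_)
open import Data.Empty using (⊥-elim)
open import Function using (_∘_; id)
open import Relation.Nullary using (Dec; yes; no; ¬_; ¬?)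
open import Relation.Nullary.Decidable using (_×-dec_)
open import Relation.Binary.PropositionalEquality
  using (refl; sym; trans; cong; cong₂; subst; module ≡-Reasoning)
open import Data.Nat.Tactic.RingSolver renaming (solve-∀ to ℕ-solve-∀)
open import Data.Integer.Tactic.RingSolver using (solve-∀)

open ≡-Reasoning

𝟙 : ∀ {p} {P : Set p} → Dec P → ℕ
𝟙 (yes _) = 1
𝟙 (no _)  = 0

𝟙-yes : ∀ {p} {P : Set p} → P → (p? : Dec P) → 𝟙 p? ≡ 1
𝟙-yes p (yes _) = refl
𝟙-yes p (no ¬p) = ⊥-elim (¬p p)

𝟙-no : ∀ {p} {P : Set p} → ¬ P → (p? : Dec P) → 𝟙 p? ≡ 0
𝟙-no ¬p (yes p) = ⊥-elim (¬p p)
𝟙-no ¬p (no _)  = refl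

𝟙-⇔ : ∀ {p q} {P : Set p} {Q : Set q} → (P → Q) → (Q → P) →
      (p? : Dec P) (q? : Dec Q) → 𝟙 p? ≡ 𝟙 q?
𝟙-⇔ to from (yes p) (yes q) = refl
𝟙-⇔ to from (yes p) (no ¬q) = ⊥-elim (¬q (to p))
𝟙-⇔ to from (no ¬p) (yes q) = ⊥-elim (¬p (from q))
𝟙-⇔ to from (no ¬p) (no ¬q) = refl

𝟙-× : ∀ {p q} {P : Set p} {Q : Set q} (p? : Dec P) (q? : Dec Q) →
      𝟙 (p? ×-dec q?) ≡ 𝟙 p? ⊗ 𝟙 q?
𝟙-× (yes p) (yes q) = refl
𝟙-× (yes p) (no ¬q) = refl
𝟙-× (no ¬p) q?      = refl

Sum : {A : Set} → List A → (A → ℕ) → ℕ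
Sum []       f = 0
Sum (x ∷ xs) f = f x ⊕ Sum xs f

Sum-++ : {A : Set} (xs ys : List A) (f : A → ℕ) → Sum (xs ++ ys) f ≡ Sum xs f ⊕ Sum ys f
Sum-++ []       ys f = refl
Sum-++ (x ∷ xs) ys f = trans (cong (f x ⊕_) (Sum-++ xs ys f)) (sym (ℕP.+-assoc (f x) _ _))

Sum-map : {A B : Set} (g : A → B) (xs : List A) (f : B → ℕ) → Sum (map g xs) f ≡ Sum xs (f ∘ g)
Sum-map g []       f = refl
Sum-map g (x ∷ xs) f = cong (f (g x) ⊕_) (Sum-map g xs f)

Sum-concatMap : {A B : Set} (g : A → List B) (xs : List A) (f : B → ℕ) →
                Sum (concatMap g xs) f ≡ Sum xs (λ x → Sum (g x) f)
Sum-concatMap g []       f = refl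
Sum-concatMap g (x ∷ xs) f =
  trans (Sum-++ (g x) (concatMap g xs) f) (cong (Sum (g x) f ⊕_) (Sum-concatMap g xs f))

Sum-cong : {A : Set} (xs : List A) {f g : A → ℕ} → All (λ x → f x ≡ g x) xs → Sum xs f ≡ Sum xs g
Sum-cong []       []       = refl
Sum-cong (x ∷ xs) (p ∷ ps) = cong₂ _⊕_ p (Sum-cong xs ps)

Sum-ext : {A : Set} (xs : List A) {f g : A → ℕ} → (∀ x → f x ≡ g x) → Sum xs f ≡ Sum xs g
Sum-ext xs h = Sum-cong xs (All.tabulate (λ {x} _ → h x))

Sum-+ : {A : Set} (xs : List A) (f g : A → ℕ) → Sum xs (λ x → f x ⊕ g x) ≡ Sum xs f ⊕ Sum xs g
Sum-+ []       f g = refl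
Sum-+ (x ∷ xs) f g = trans (cong ((f x ⊕ g x) ⊕_) (Sum-+ xs f g)) (interchange (f x) (g x) _ _)
  where
  interchange : ∀ a b c d → (a ⊕ b) ⊕ (c ⊕ d) ≡ (a ⊕ c) ⊕ (b ⊕ d)
  interchange = ℕ-solve-∀

Sum-* : {A : Set} (xs : List A) (c : ℕ) (f : A → ℕ) → Sum xs (λ x → c ⊗ f x) ≡ c ⊗ Sum xs f
Sum-* []       c f = sym (ℕP.*-zeroʳ c)
Sum-* (x ∷ xs) c f = trans (cong (c ⊗ f x ⊕_) (Sum-* xs c f)) (sym (ℕP.*-distribˡ-+ c (f x) _))

Sum-const : {A : Set} (xs : List A) (c : ℕ) → Sum xs (λ _ → c) ≡ length xs ⊗ c
Sum-const []       c = refl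
Sum-const (x ∷ xs) c = cong (c ⊕_) (Sum-const xs c)

length-filter : {A : Set} {P : A → Set} (P? : (x : A) → Dec (P x)) (xs : List A) →
                length (filter P? xs) ≡ Sum xs (λ x → 𝟙 (P? x))
length-filter P? []       = refl
length-filter P? (x ∷ xs) with P? x
... | yes _ = cong suc (length-filter P? xs)
... | no _  = length-filter P? xs

Sum-filter : {A : Set} {P : A → Set} (P? : (x : A) → Dec (P x)) (xs : List A) (f : A → ℕ) →
             Sum (filter P? xs) f ≡ Sum xs (λ x → 𝟙 (P? x) ⊗ f x)
Sum-filter P? []       f = refl
Sum-filter P? (x ∷ xs) f with P? x
... | yes _ = cong₂ _⊕_ (sym (ℕP.*-identityˡ (f x))) (Sum-filter P? xs f)
... | no _  = Sum-filter P? xs f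

Sum-upTo-suc : (N : ℕ) (f : ℕ → ℕ) → Sum (upTo (suc N)) f ≡ Sum (upTo N) f ⊕ f N
Sum-upTo-suc N f = begin
  Sum (upTo (suc N)) f        ≡⟨ cong (λ l → Sum l f) (sym (ListP.applyUpTo-∷ʳ id N)) ⟩
  Sum (upTo N ++ [ N ]) f     ≡⟨ Sum-++ (upTo N) [ N ] f ⟩
  Sum (upTo N) f ⊕ (f N ⊕ 0)  ≡⟨ cong (Sum (upTo N) f ⊕_) (ℕP.+-identityʳ (f N)) ⟩
  Sum (upTo N) f ⊕ f N        ∎

Sum-δ-out : (N y : ℕ) (g : ℕ → ℕ) → N ≤ y → Sum (upTo N) (λ v → 𝟙 (y ≟ v) ⊗ g v) ≡ 0
Sum-δ-out zero    y g N≤y = refl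
Sum-δ-out (suc N) y g N<y =
  trans (Sum-upTo-suc N _)
        (cong₂ _⊕_ (Sum-δ-out N y g (ℕP.<⇒≤ N<y))
                   (cong (_⊗ g N) (𝟙-no (λ y≡N → ℕP.<-irrefl (sym y≡N) N<y) (y ≟ N))))

Sum-δ : (N y : ℕ) (g : ℕ → ℕ) → y < N → Sum (upTo N) (λ v → 𝟙 (y ≟ v) ⊗ g v) ≡ g y
Sum-δ (suc N) y g y<1+N = trans (Sum-upTo-suc N _) (last-term (y ≟ N))
  where
  last-term : (y≟N : Dec (y ≡ N)) → Sum (upTo N) (λ v → 𝟙 (y ≟ v) ⊗ g v) ⊕ 𝟙 y≟N ⊗ g N ≡ g y
  last-term (yes refl) = trans (cong (_⊕ (g y ⊕ 0)) (Sum-δ-out N y g ℕP.≤-refl)) (ℕP.+-identityʳ (g y))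
  last-term (no y≢N)   =
    trans (cong (_⊕ 0) (Sum-δ N y g (ℕP.≤∧≢⇒< (ℕP.≤-pred y<1+N) y≢N))) (ℕP.+-identityʳ (g y))

occ-∷ : ∀ v y e → occ v (y ∷ e) ≡ 𝟙 (y ≟ v) ⊕ occ v e
occ-∷ v y e with y ≟ v
... | yes y≡v = cong length (ListP.filter-accept (_≟ v) y≡v)
... | no y≢v  = cong length (ListP.filter-reject (_≟ v) y≢v)

occ-snoc : ∀ v e x → occ v (e ++ [ x ]) ≡ occ v e ⊕ 𝟙 (x ≟ v)
occ-snoc v e x = begin
  occ v (e ++ [ x ])                               ≡⟨ cong length (ListP.filter-++ (_≟ v) e [ x ]) ⟩
  length (filter (_≟ v) e ++ filter (_≟ v) [ x ])  ≡⟨ ListP.length-++ (filter (_≟ v) e) ⟩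
  occ v e ⊕ occ v [ x ]                            ≡⟨ cong (occ v e ⊕_) (occ-∷ v x []) ⟩
  occ v e ⊕ (𝟙 (x ≟ v) ⊕ 0)                        ≡⟨ cong (occ v e ⊕_) (ℕP.+-identityʳ _) ⟩
  occ v e ⊕ 𝟙 (x ≟ v)                              ∎

occ-snoc-self : ∀ e x → occ x (e ++ [ x ]) ≡ suc (occ x e)
occ-snoc-self e x =
  trans (occ-snoc x e x) (trans (cong (occ x e ⊕_) (𝟙-yes refl (x ≟ x))) (ℕP.+-comm (occ x e) 1))

occ-pos⇒∈ : ∀ v e → 0 < occ v e → v ∈ e
occ-pos⇒∈ v (y ∷ e) 0<occ = entry (y ≟ v) (subst (0 <_) (occ-∷ v y e) 0<occ)
  where
  entry : (y≟v : Dec (y ≡ v)) → 0 < 𝟙 y≟v ⊕ occ v e → v ∈ y ∷ e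
  entry (yes refl) _  = here refl
  entry (no _) 0<occ′ = there (occ-pos⇒∈ v e 0<occ′)

Sum-occ : ∀ N e → All (_< N) e → Sum (upTo N) (λ v → occ v e) ≡ length e
Sum-occ N []      []           = trans (Sum-const (upTo N) 0) (ℕP.*-zeroʳ (length (upTo N)))
Sum-occ N (y ∷ e) (y<N ∷ e<N) = begin
  Sum (upTo N) (λ v → occ v (y ∷ e))                        ≡⟨ Sum-ext (upTo N) (λ v → occ-∷ v y e) ⟩
  Sum (upTo N) (λ v → 𝟙 (y ≟ v) ⊕ occ v e)                  ≡⟨ Sum-+ (upTo N) _ _ ⟩
  Sum (upTo N) (λ v → 𝟙 (y ≟ v)) ⊕ Sum (upTo N) (λ v → occ v e)
    ≡⟨ cong₂ _⊕_ (trans (Sum-ext (upTo N) (λ v → sym (ℕP.*-identityʳ (𝟙 (y ≟ v)))))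
                        (Sum-δ N y (λ _ → 1) y<N))
                 (Sum-occ N e e<N) ⟩
  suc (length e)                                            ∎

-- Removing the copies of y (as deduplication does) kills the occurrences of y
-- and leaves those of every other value unchanged.
remove : ℕ → List ℕ → List ℕ
remove y = filter (¬? ∘ _≟_ y)

occ-remove-self : ∀ y D → occ y (remove y D) ≡ 0
occ-remove-self y []      = refl
occ-remove-self y (z ∷ D) with y ≟ z
... | yes y≡z = trans (cong (occ y) (ListP.filter-reject (¬? ∘ _≟_ y) (λ y≢z → y≢z y≡z)))
                      (occ-remove-self y D)
... | no y≢z  = begin
  occ y (remove y (z ∷ D))      ≡⟨ cong (occ y) (ListP.filter-accept (¬? ∘ _≟_ y) y≢z) ⟩
  occ y (z ∷ remove y D)        ≡⟨ occ-∷ y z _ ⟩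
  𝟙 (z ≟ y) ⊕ occ y (remove y D) ≡⟨ cong₂ _⊕_ (𝟙-no (y≢z ∘ sym) (z ≟ y)) (occ-remove-self y D) ⟩
  0                             ∎

occ-remove-other : ∀ x y D → ¬ (y ≡ x) → occ x (remove y D) ≡ occ x D
occ-remove-other x y []      y≢x = refl
occ-remove-other x y (z ∷ D) y≢x with y ≟ z
... | yes refl = begin
  occ x (remove y (y ∷ D)) ≡⟨ cong (occ x) (ListP.filter-reject (¬? ∘ _≟_ y) (λ y≢y → y≢y refl)) ⟩
  occ x (remove y D)       ≡⟨ occ-remove-other x y D y≢x ⟩
  occ x D                  ≡⟨ cong (_⊕ occ x D) (sym (𝟙-no y≢x (y ≟ x))) ⟩
  𝟙 (y ≟ x) ⊕ occ x D      ≡⟨ sym (occ-∷ x y D) ⟩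
  occ x (y ∷ D)            ∎
... | no y≢z = begin
  occ x (remove y (z ∷ D))        ≡⟨ cong (occ x) (ListP.filter-accept (¬? ∘ _≟_ y) y≢z) ⟩
  occ x (z ∷ remove y D)          ≡⟨ occ-∷ x z _ ⟩
  𝟙 (z ≟ x) ⊕ occ x (remove y D)  ≡⟨ cong (𝟙 (z ≟ x) ⊕_) (occ-remove-other x y D y≢x) ⟩
  𝟙 (z ≟ x) ⊕ occ x D             ≡⟨ sym (occ-∷ x z D) ⟩
  occ x (z ∷ D)                   ∎

occ-deduplicate : ∀ x e → occ x (deduplicate _≟_ e) ≡ 𝟙 (0 <? occ x e)
occ-deduplicate x []      = refl
occ-deduplicate x (y ∷ e) =
  trans (occ-∷ x y _) (trans (by-head (y ≟ x)) (cong (𝟙 ∘ (0 <?_)) (sym (occ-∷ x y e))))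
  where
  by-head : (y≟x : Dec (y ≡ x)) →
            𝟙 y≟x ⊕ occ x (remove y (deduplicate _≟_ e)) ≡ 𝟙 (0 <? (𝟙 y≟x ⊕ occ x e))
  by-head (yes refl) = cong suc (occ-remove-self y (deduplicate _≟_ e))
  by-head (no y≢x)   = trans (occ-remove-other x y (deduplicate _≟_ e) y≢x) (occ-deduplicate x e)

distinct-as-Sum : ∀ N e → All (_< N) e → distinct e ≡ Sum (upTo N) (λ v → 𝟙 (0 <? occ v e))
distinct-as-Sum N e e<N =
  trans (sym (Sum-occ N (deduplicate _≟_ e) (AllP.deduplicate⁺ _≟_ e<N)))
        (Sum-ext (upTo N) (λ v → occ-deduplicate v e))

distinct-snoc : ∀ N e x → All (_< N) e → x < N →
                distinct (e ++ [ x ]) ≡ 𝟙 (occ x e ≟ 0) ⊕ distinct e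
distinct-snoc N e x e<N x<N = begin
  distinct (e ++ [ x ])
    ≡⟨ distinct-as-Sum N (e ++ [ x ]) (AllP.++⁺ e<N (x<N ∷ [])) ⟩
  Sum (upTo N) (λ v → 𝟙 (0 <? occ v (e ++ [ x ])))
    ≡⟨ Sum-ext (upTo N) (λ v → trans (cong (𝟙 ∘ (0 <?_)) (occ-snoc v e x))
                                      (occurs-snoc (occ v e) (x ≟ v))) ⟩
  Sum (upTo N) (λ v → 𝟙 (0 <? occ v e) ⊕ 𝟙 (x ≟ v) ⊗ 𝟙 (occ v e ≟ 0))
    ≡⟨ Sum-+ (upTo N) _ _ ⟩
  Sum (upTo N) (λ v → 𝟙 (0 <? occ v e)) ⊕ Sum (upTo N) (λ v → 𝟙 (x ≟ v) ⊗ 𝟙 (occ v e ≟ 0))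
    ≡⟨ cong₂ _⊕_ (sym (distinct-as-Sum N e e<N)) (Sum-δ N x (λ v → 𝟙 (occ v e ≟ 0)) x<N) ⟩
  distinct e ⊕ 𝟙 (occ x e ≟ 0)
    ≡⟨ ℕP.+-comm (distinct e) _ ⟩
  𝟙 (occ x e ≟ 0) ⊕ distinct e ∎
  where
  occurs-snoc : ∀ {v} o (x≟v : Dec (x ≡ v)) →
                𝟙 (0 <? (o ⊕ 𝟙 x≟v)) ≡ 𝟙 (0 <? o) ⊕ 𝟙 x≟v ⊗ 𝟙 (o ≟ 0)
  occurs-snoc zero    (yes _) = refl
  occurs-snoc (suc o) (yes _) = refl
  occurs-snoc o       (no _)  =
    trans (cong (𝟙 ∘ (0 <?_)) (ℕP.+-identityʳ o)) (sym (ℕP.+-identityʳ _))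

occ<3 : ∀ e → Avoids000 e → ∀ v → occ v e < 3
occ<3 e avoids v with occ v e in eq
... | zero  = s≤s z≤n
... | suc o = subst (_< 3) eq (All.lookup avoids (occ-pos⇒∈ v e (subst (0 <_) (sym eq) (s≤s z≤n))))

avoids-snoc⁻ : ∀ e x → Avoids000 (e ++ [ x ]) → Avoids000 e × occ x e < 2
avoids-snoc⁻ e x avoids with AllP.++⁻ e avoids
... | avoids-e , (x-ok ∷ []) =
  All.map (λ {v} v-ok → ℕP.≤-<-trans (ℕP.m≤m+n (occ v e) _) (subst (_< 3) (occ-snoc v e x) v-ok))
          avoids-e ,
  ℕP.≤-pred (subst (_< 3) (occ-snoc-self e x) x-ok)

avoids-snoc⁺ : ∀ e x → Avoids000 e × occ x e < 2 → Avoids000 (e ++ [ x ])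
avoids-snoc⁺ e x (avoids , x<2) =
  AllP.++⁺ (All.map (λ {v} v-ok → after v v-ok) avoids) (after x (ℕP.m<n⇒m<1+n x<2) ∷ [])
  where
  bump : ∀ {v} (x≟v : Dec (x ≡ v)) → occ v e < 3 → occ v e ⊕ 𝟙 x≟v < 3
  bump (yes refl) _    = subst (_< 3) (ℕP.+-comm 1 (occ x e)) (s≤s x<2)
  bump (no _)     v-ok = subst (_< 3) (sym (ℕP.+-identityʳ _)) v-ok
  after : ∀ v → occ v e < 3 → occ v (e ++ [ x ]) < 3
  after v v-ok = subst (_< 3) (sym (occ-snoc v e x)) (bump (x ≟ v) v-ok)

avoids-snoc : ∀ e x → 𝟙 (avoids000? (e ++ [ x ])) ≡ 𝟙 (avoids000? e) ⊗ 𝟙 (occ x e <? 2)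
avoids-snoc e x =
  trans (𝟙-⇔ (avoids-snoc⁻ e x) (avoids-snoc⁺ e x)
             (avoids000? (e ++ [ x ])) (avoids000? e ×-dec (occ x e <? 2)))
        (𝟙-× (avoids000? e) (occ x e <? 2))

values-occurring : ℕ → List ℕ → ℕ → ℕ
values-occurring N e j = Sum (upTo N) (λ v → 𝟙 (occ v e ≟ j))

unit-cases : ∀ o → o < 3 → 1 ≡ 𝟙 (o ≟ 0) ⊕ (𝟙 (o ≟ 1) ⊕ 𝟙 (o ≟ 2))
unit-cases zero                _ = refl
unit-cases (suc zero)          _ = refl
unit-cases (suc (suc zero))    _ = refl
unit-cases (suc (suc (suc o))) (s≤s (s≤s (s≤s ())))

count-cases : ∀ o → o < 3 → o ≡ 𝟙 (o ≟ 1) ⊕ 2 ⊗ 𝟙 (o ≟ 2)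
count-cases zero                _ = refl
count-cases (suc zero)          _ = refl
count-cases (suc (suc zero))    _ = refl
count-cases (suc (suc (suc o))) (s≤s (s≤s (s≤s ())))

occurs-cases : ∀ o → o < 3 → 𝟙 (0 <? o) ≡ 𝟙 (o ≟ 1) ⊕ 𝟙 (o ≟ 2)
occurs-cases zero                _ = refl
occurs-cases (suc zero)          _ = refl
occurs-cases (suc (suc zero))    _ = refl
occurs-cases (suc (suc (suc o))) (s≤s (s≤s (s≤s ())))

-- Writing aⱼ = values-occurring N e j for e avoiding 000 with entries below N:
-- counting values gives a₀ + d = N and counting entries gives a₁ + |e| = 2d.
module Profile (N : ℕ) (e : List ℕ) (e<N : All (_< N) e) (avoids : Avoids000 e) where

  private
    a : ℕ → ℕ
    a = values-occurring N e

    Sum-cases : {f g : ℕ → ℕ} → (∀ o → o < 3 → f o ≡ g o) →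
                Sum (upTo N) (λ v → f (occ v e)) ≡ Sum (upTo N) (λ v → g (occ v e))
    Sum-cases h = Sum-ext (upTo N) (λ v → h (occ v e) (occ<3 e avoids v))

    distinct-profile : distinct e ≡ a 1 ⊕ a 2
    distinct-profile =
      trans (distinct-as-Sum N e e<N) (trans (Sum-cases occurs-cases) (Sum-+ (upTo N) _ _))

  absent+distinct : a 0 ⊕ distinct e ≡ N
  absent+distinct = begin
    a 0 ⊕ distinct e               ≡⟨ cong (a 0 ⊕_) distinct-profile ⟩
    a 0 ⊕ (a 1 ⊕ a 2)              ≡⟨ cong (a 0 ⊕_) (sym (Sum-+ (upTo N) _ _)) ⟩
    a 0 ⊕ Sum (upTo N) (λ v → 𝟙 (occ v e ≟ 1) ⊕ 𝟙 (occ v e ≟ 2))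
                                   ≡⟨ sym (Sum-+ (upTo N) _ _) ⟩
    Sum (upTo N) (λ v → 𝟙 (occ v e ≟ 0) ⊕ (𝟙 (occ v e ≟ 1) ⊕ 𝟙 (occ v e ≟ 2)))
                                   ≡⟨ sym (Sum-cases unit-cases) ⟩
    Sum (upTo N) (λ _ → 1)         ≡⟨ Sum-const (upTo N) 1 ⟩
    length (upTo N) ⊗ 1            ≡⟨ ℕP.*-identityʳ _ ⟩
    length (upTo N)                ≡⟨ ListP.length-upTo N ⟩
    N                              ∎

  single+length : a 1 ⊕ length e ≡ 2 ⊗ distinct e
  single+length = begin
    a 1 ⊕ length e                 ≡⟨ cong (a 1 ⊕_) (sym (Sum-occ N e e<N)) ⟩
    a 1 ⊕ Sum (upTo N) (λ v → occ v e)
                                   ≡⟨ cong (a 1 ⊕_) (Sum-cases count-cases) ⟩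
    a 1 ⊕ Sum (upTo N) (λ v → 𝟙 (occ v e ≟ 1) ⊕ 2 ⊗ 𝟙 (occ v e ≟ 2))
                                   ≡⟨ cong (a 1 ⊕_) (Sum-+ (upTo N) _ _) ⟩
    a 1 ⊕ (a 1 ⊕ Sum (upTo N) (λ v → 2 ⊗ 𝟙 (occ v e ≟ 2)))
                                   ≡⟨ cong (λ s → a 1 ⊕ (a 1 ⊕ s)) (Sum-* (upTo N) 2 _) ⟩
    a 1 ⊕ (a 1 ⊕ 2 ⊗ a 2)          ≡⟨ regroup (a 1) (a 2) ⟩
    2 ⊗ (a 1 ⊕ a 2)                ≡⟨ cong (2 ⊗_) (sym distinct-profile) ⟩
    2 ⊗ distinct e                 ∎
    where
    regroup : ∀ s t → s ⊕ (s ⊕ 2 ⊗ t) ≡ 2 ⊗ (s ⊕ t)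
    regroup = ℕ-solve-∀

counted : ℕ → List ℕ → ℕ
counted k e = 𝟙 (avoids000? e) ⊗ 𝟙 (distinct e ≟ k)

-- Contribution of appending a value occurring o times to a 000-avoiding
-- sequence with d distinct entries.
extension-weight : ℕ → ℕ → ℕ → ℕ
extension-weight k d o = 𝟙 (o <? 2) ⊗ 𝟙 (𝟙 (o ≟ 0) ⊕ d ≟ k)

counted-snoc : ∀ N k e x → All (_< N) e → x < N →
               counted k (e ++ [ x ]) ≡ 𝟙 (avoids000? e) ⊗ extension-weight k (distinct e) (occ x e)
counted-snoc N k e x e<N x<N = begin
  𝟙 (avoids000? (e ++ [ x ])) ⊗ 𝟙 (distinct (e ++ [ x ]) ≟ k)
    ≡⟨ cong₂ _⊗_ (avoids-snoc e x) (cong (𝟙 ∘ (_≟ k)) (distinct-snoc N e x e<N x<N)) ⟩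
  𝟙 (avoids000? e) ⊗ 𝟙 (occ x e <? 2) ⊗ 𝟙 (𝟙 (occ x e ≟ 0) ⊕ distinct e ≟ k)
    ≡⟨ ℕP.*-assoc (𝟙 (avoids000? e)) _ _ ⟩
  𝟙 (avoids000? e) ⊗ extension-weight k (distinct e) (occ x e) ∎

extension-weight-cases : ∀ k d o →
  extension-weight k d o ≡ 𝟙 (suc d ≟ k) ⊗ 𝟙 (o ≟ 0) ⊕ 𝟙 (d ≟ k) ⊗ 𝟙 (o ≟ 1)
extension-weight-cases k d zero          = absent (𝟙 (suc d ≟ k)) (𝟙 (d ≟ k))
  where
  absent : ∀ s t → 1 ⊗ s ≡ s ⊗ 1 ⊕ t ⊗ 0
  absent = ℕ-solve-∀
extension-weight-cases k d (suc zero)    = single (𝟙 (suc d ≟ k)) (𝟙 (d ≟ k))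
  where
  single : ∀ s t → 1 ⊗ t ≡ s ⊗ 0 ⊕ t ⊗ 1
  single = ℕ-solve-∀
extension-weight-cases k d (suc (suc o)) = double (𝟙 (suc d ≟ k)) (𝟙 (d ≟ k))
  where
  double : ∀ s t → 0 ≡ s ⊗ 0 ⊕ t ⊗ 0
  double = ℕ-solve-∀

Sum-extension-weight : ∀ N k d e →
  Sum (upTo N) (λ x → extension-weight k d (occ x e))
    ≡ 𝟙 (suc d ≟ k) ⊗ values-occurring N e 0 ⊕ 𝟙 (d ≟ k) ⊗ values-occurring N e 1
Sum-extension-weight N k d e =
  trans (Sum-ext (upTo N) (λ x → extension-weight-cases k d (occ x e)))
        (trans (Sum-+ (upTo N) _ _)
               (cong₂ _⊕_ (Sum-* (upTo N) (𝟙 (suc d ≟ k)) (λ x → 𝟙 (occ x e ≟ 0)))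
                          (Sum-* (upTo N) (𝟙 (d ≟ k)) (λ x → 𝟙 (occ x e ≟ 1)))))

𝟙-weighted : ∀ {p} {P : Set p} (p? : Dec P) (a : ℕ) (c : ℤ) →
             (P → + a ≡ c) → + (𝟙 p? ⊗ a) ≡ c * + 𝟙 p?
𝟙-weighted (yes p) a c a≡c =
  trans (cong +_ (ℕP.*-identityˡ a)) (trans (a≡c p) (sym (ℤP.*-identityʳ c)))
𝟙-weighted (no _)  a c a≡c = sym (ℤP.*-zeroʳ c)

absent-coeff single-coeff : ℕ → ℕ → ℤ
absent-coeff n k = + suc n - + k + + 1
single-coeff n k = + 2 * + k - + suc n + + 1

-- Integer form of a ≡ (a + t) ∸ t, with the subtraction written as in the coefficients.
cancel-shift : ∀ a t → + a ≡ + (a ⊕ t) - + suc t + + 1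
cancel-shift a t = begin
  + a                            ≡⟨ shift (+ a) (+ t) ⟩
  (+ a + + t) - (+ 1 + + t) + + 1 ≡⟨ cong₂ (λ s u → s - u + + 1) (sym (ℤP.pos-+ a t)) (sym (ℤP.pos-+ 1 t)) ⟩
  + (a ⊕ t) - + suc t + + 1      ∎
  where
  shift : ∀ s u → s ≡ (s + u) - (+ 1 + u) + + 1
  shift = solve-∀

-- The coefficients arise as a₀ (from a₀ + d = n+1 at d = k-1) and as a₁
-- (from a₁ + n = 2d at d = k).
absent-coefficient : ∀ n a₀ d k → 1 ≤ k → a₀ ⊕ d ≡ suc n → d ≡ k ∸ 1 → + a₀ ≡ absent-coeff n k
absent-coefficient n a₀ d (suc d) _ sum refl =
  trans (cancel-shift a₀ d) (cong (λ s → + s - + suc d + + 1) sum)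

single-coefficient : ∀ n a₁ d k → a₁ ⊕ n ≡ 2 ⊗ d → d ≡ k → + a₁ ≡ single-coeff n k
single-coefficient n a₁ d d sum refl =
  trans (cancel-shift a₁ n) (cong (λ s → s - + suc n + + 1) (trans (cong +_ sum) (ℤP.pos-* 2 d)))

avoiding-extensions : ∀ n k e → 1 ≤ k → length e ≡ n → All (_< suc n) e → Avoids000 e →
  + Sum (upTo (suc n)) (λ x → extension-weight k (distinct e) (occ x e))
    ≡ absent-coeff n k * + 𝟙 (distinct e ≟ k ∸ 1) + single-coeff n k * + 𝟙 (distinct e ≟ k)
avoiding-extensions n k e 1≤k len e<N avoids = begin
  + Sum (upTo (suc n)) (λ x → extension-weight k d (occ x e))
    ≡⟨ cong +_ (Sum-extension-weight (suc n) k d e) ⟩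
  + (𝟙 (suc d ≟ k) ⊗ a 0 ⊕ 𝟙 (d ≟ k) ⊗ a 1)
    ≡⟨ ℤP.pos-+ (𝟙 (suc d ≟ k) ⊗ a 0) _ ⟩
  + (𝟙 (suc d ≟ k) ⊗ a 0) + + (𝟙 (d ≟ k) ⊗ a 1)
    ≡⟨ cong (λ i → + (i ⊗ a 0) + + (𝟙 (d ≟ k) ⊗ a 1)) (shift-index 1≤k) ⟩
  + (𝟙 (d ≟ k ∸ 1) ⊗ a 0) + + (𝟙 (d ≟ k) ⊗ a 1)
    ≡⟨ cong₂ _+_
         (𝟙-weighted (d ≟ k ∸ 1) (a 0) _ (absent-coefficient n (a 0) d k 1≤k absent+distinct))
         (𝟙-weighted (d ≟ k) (a 1) _
           (single-coefficient n (a 1) d k (subst (λ m → a 1 ⊕ m ≡ 2 ⊗ d) len single+length))) ⟩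
  absent-coeff n k * + 𝟙 (d ≟ k ∸ 1) + single-coeff n k * + 𝟙 (d ≟ k) ∎
  where
  open Profile (suc n) e e<N avoids
  d : ℕ
  d = distinct e
  a : ℕ → ℕ
  a = values-occurring (suc n) e
  shift-index : 1 ≤ k → 𝟙 (suc d ≟ k) ≡ 𝟙 (d ≟ k ∸ 1)
  shift-index (s≤s _) = 𝟙-⇔ ℕP.suc-injective (cong suc) (suc d ≟ k) (d ≟ k ∸ 1)

linear-zero : ∀ X Y → + 0 ≡ X * + 0 + Y * + 0
linear-zero X Y = sym (cong₂ _+_ (ℤP.*-zeroʳ X) (ℤP.*-zeroʳ Y))

𝟙-guarded : ∀ {p} {P : Set p} (p? : Dec P) (s t u : ℕ) (X Y : ℤ) →
            (P → + s ≡ X * + t + Y * + u) →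
            + (𝟙 p? ⊗ s) ≡ X * + (𝟙 p? ⊗ t) + Y * + (𝟙 p? ⊗ u)
𝟙-guarded (yes p) s t u X Y identity =
  trans (cong +_ (ℕP.*-identityˡ s))
        (trans (identity p)
               (sym (cong₂ (λ t′ u′ → X * + t′ + Y * + u′) (ℕP.*-identityˡ t) (ℕP.*-identityˡ u))))
𝟙-guarded (no _)  s t u X Y identity = linear-zero X Y

extensions : ∀ n k e → 1 ≤ k → length e ≡ n → All (_< suc n) e →
  + Sum (upTo (suc n)) (λ x → counted k (e ++ [ x ]))
    ≡ absent-coeff n k * + counted (k ∸ 1) e + single-coeff n k * + counted k e
extensions n k e 1≤k len e<N = begin
  + Sum (upTo (suc n)) (λ x → counted k (e ++ [ x ]))
    ≡⟨ cong +_ (Sum-cong (upTo (suc n)) (AllP.applyUpTo⁺₁ id (suc n) (counted-snoc (suc n) k e _ e<N))) ⟩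
  + Sum (upTo (suc n)) (λ x → 𝟙 (avoids000? e) ⊗ weight x)
    ≡⟨ cong +_ (Sum-* (upTo (suc n)) (𝟙 (avoids000? e)) weight) ⟩
  + (𝟙 (avoids000? e) ⊗ Sum (upTo (suc n)) weight)
    ≡⟨ 𝟙-guarded (avoids000? e) _ (𝟙 (distinct e ≟ k ∸ 1)) (𝟙 (distinct e ≟ k))
                 (absent-coeff n k) (single-coeff n k) (avoiding-extensions n k e 1≤k len e<N) ⟩
  absent-coeff n k * + counted (k ∸ 1) e + single-coeff n k * + counted k e ∎
  where
  weight : ℕ → ℕ
  weight x = extension-weight k (distinct e) (occ x e)

Sum-linear : {A : Set} (xs : List A) (f g h : A → ℕ) (X Y : ℤ) →
             All (λ x → + f x ≡ X * + g x + Y * + h x) xs →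
             + Sum xs f ≡ X * + Sum xs g + Y * + Sum xs h
Sum-linear []       f g h X Y []       = linear-zero X Y
Sum-linear (x ∷ xs) f g h X Y (p ∷ ps) = begin
  + (f x ⊕ Sum xs f)
    ≡⟨ ℤP.pos-+ (f x) _ ⟩
  + f x + + Sum xs f
    ≡⟨ cong₂ _+_ p (Sum-linear xs f g h X Y ps) ⟩
  (X * + g x + Y * + h x) + (X * + Sum xs g + Y * + Sum xs h)
    ≡⟨ regroup X Y _ _ _ _ ⟩
  X * (+ g x + + Sum xs g) + Y * (+ h x + + Sum xs h)
    ≡⟨ cong₂ (λ s t → X * s + Y * t) (sym (ℤP.pos-+ (g x) _)) (sym (ℤP.pos-+ (h x) _)) ⟩
  X * + (g x ⊕ Sum xs g) + Y * + (h x ⊕ Sum xs h) ∎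
  where
  regroup : ∀ X Y a b s t → (X * a + Y * b) + (X * s + Y * t) ≡ X * (a + s) + Y * (b + t)
  regroup = solve-∀

I-shape : ∀ n → All (λ e → length e ≡ n × All (_< n) e) (I n)
I-shape zero    = (refl , []) ∷ []
I-shape (suc n) = AllP.concat⁺ (AllP.map⁺ (All.map extend (I-shape n)))
  where
  extend : ∀ {e} → length e ≡ n × All (_< n) e →
           All (λ e′ → length e′ ≡ suc n × All (_< suc n) e′)
               (map (λ x → e ++ [ x ]) (upTo (suc n)))
  extend {e} (len , e<n) = AllP.map⁺ (AllP.applyUpTo⁺₁ id (suc n) (λ x<1+n →
    trans (ListP.length-++ e) (trans (cong (_⊕ 1) len) (ℕP.+-comm n 1)) ,
    AllP.++⁺ (All.map ℕP.m<n⇒m<1+n e<n) (x<1+n ∷ [])))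

E-as-Sum : ∀ n k → E n k ≡ Sum (I n) (counted k)
E-as-Sum n k = trans (length-filter (λ e → distinct e ≟ k) (filter avoids000? (I n)))
                     (Sum-filter avoids000? (I n) (λ e → 𝟙 (distinct e ≟ k)))

E-suc : ∀ n k → E (suc n) k ≡ Sum (I n) (λ e → Sum (upTo (suc n)) (λ x → counted k (e ++ [ x ])))
E-suc n k = begin
  E (suc n) k                  ≡⟨ E-as-Sum (suc n) k ⟩
  Sum (I (suc n)) (counted k)  ≡⟨ Sum-concatMap extensions-of (I n) (counted k) ⟩
  Sum (I n) (λ e → Sum (extensions-of e) (counted k))
                               ≡⟨ Sum-ext (I n) (λ e → Sum-map (λ x → e ++ [ x ]) (upTo (suc n)) (counted k)) ⟩
  Sum (I n) (λ e → Sum (upTo (suc n)) (λ x → counted k (e ++ [ x ]))) ∎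
  where
  extensions-of : List ℕ → List (List ℕ)
  extensions-of e = map (λ x → e ++ [ x ]) (upTo (suc n))

theorem8 : (n k : ℕ) → 1 ≤ k → k ≤ suc n →
    + E (suc n) k ≡ (+ (suc n) - + k + + 1) * + E n (k ∸ 1)
                    + (+ 2 * + k - + (suc n) + + 1) * + E n k
theorem8 n k 1≤k _ = begin
  + E (suc n) k
    ≡⟨ cong +_ (E-suc n k) ⟩
  + Sum (I n) (λ e → Sum (upTo (suc n)) (λ x → counted k (e ++ [ x ])))
    ≡⟨ Sum-linear (I n) _ (counted (k ∸ 1)) (counted k) (absent-coeff n k) (single-coeff n k)
         (All.map (λ {e} (len , e<n) → extensions n k e 1≤k len (All.map ℕP.m<n⇒m<1+n e<n)) (I-shape n)) ⟩
  absent-coeff n k * + Sum (I n) (counted (k ∸ 1)) + single-coeff n k * + Sum (I n) (counted k)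
    ≡⟨ cong₂ (λ s t → absent-coeff n k * + s + single-coeff n k * + t)
             (sym (E-as-Sum n (k ∸ 1))) (sym (E-as-Sum n k)) ⟩
  absent-coeff n k * + E n (k ∸ 1) + single-coeff n k * + E n k ∎
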